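{- For all $\varphi\in\mathcal{L}_{Par}$: if $\mathsf{Full}\vdash\varphi^{nf}$ then $\mathsf{Par}\vdash\varphi$.
   Context: Fix countable $\mathsf{P}_0$, $\mathsf{G}_0$. $\mathcal{L}_{Par}$: $\varphi ::= p \mid \neg\varphi \mid \varphi\lor\varphi \mid \langle\gamma\rangle\varphi$, $\gamma ::= g \mid \gamma;\gamma \mid \gamma\sqcup\gamma \mid \gamma^* \mid \gamma^d \mid \varphi?$. $\mathcal{L}_{NF}$: $\varphi ::= p \mid \neg p \mid \varphi\lor\varphi \mid \varphi\land\varphi \mid \langle\gamma\rangle\varphi$, $\gamma ::= g \mid g^d \mid \gamma;\gamma \mid \gamma\sqcup\gamma \mid \gamma\sqcap\gamma \mid \gamma^* \mid \gamma^\times \mid \varphi? \mid \varphi!$. $\mathcal{L}_{Full}$: $\varphi ::= p \mid \neg\varphi \mid \varphi\lor\varphi \mid \langle\gamma\rangle\varphi$, $\gamma ::= g \mid \gamma;\gamma \mid \gamma\sqcup\gamma \mid \gamma\sqcap\gamma \mid \gamma^* \mid \gamma^\times \mid \gamma^d \mid \varphi? \mid \varphi!$, with $\land,\to,\leftrightarrow$ abbreviations (so $\mathcal{L}_{Par},\mathcal{L}_{NF}\subseteq\mathcal{L}_{Full}$). $(\cdot)^{nf}:\mathcal{L}_{Full}\to\mathcal{L}_{NF}$: $p^{nf}=p$, $(\neg p)^{nf}=\neg p$, $(\neg\neg\varphi)^{nf}=\varphi^{nf}$, $(\varphi\lor\psi)^{nf}=\varphi^{nf}\lor\psi^{nf}$,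 $(\neg(\varphi\lor\psi))^{nf}=(\neg\varphi)^{nf}\land(\neg\psi)^{nf}$, $(\langle\gamma\rangle\varphi)^{nf}=\langle\gamma^{nf}\rangle\varphi^{nf}$, $(\neg\langle\gamma\rangle\varphi)^{nf}=\langle(\gamma^d)^{nf}\rangle(\neg\varphi)^{nf}$; games: $g^{nf}=g$, $;,\sqcup,\sqcap,{}^*,{}^\times$ componentwise, $(\varphi?)^{nf}=\varphi^{nf}?$, $(\varphi!)^{nf}=\varphi^{nf}!$, $(g^d)^{nf}=g^d$, $((\gamma^d)^d)^{nf}=\gamma^{nf}$, $((\gamma\sqcup\delta)^d)^{nf}=(\gamma^d)^{nf}\sqcap(\delta^d)^{nf}$, $((\gamma\sqcap\delta)^d)^{nf}=(\gamma^d)^{nf}\sqcup(\delta^d)^{nf}$, $((\gamma;\delta)^d)^{nf}=(\gamma^d)^{nf};(\delta^d)^{nf}$, $((\gamma^*)^d)^{nf}=((\gamma^d)^{nf})^\times$, $((\gamma^\times)^d)^{nf}=((\gamma^d)^{nf})^*$, $((\varphi?)^d)^{nf}=(\neg\varphi)^{nf}!$, $((\varphi!)^d)^{nf}=(\neg\varphi)^{nf}?$. $\mathsf{Par}$: Hilbert system over $\mathcal{L}_{Par}$ with axioms: propositional tautologies; $\langle\gamma;\delta\rangle\varphi\leftrightarrow\langle\gamma\rangle\langle\delta\rangle\varphi$; $\langle\gamma\sqcup\delta\rangle\varphi\leftrightarrow\langle\gamma\rangle\varphi\lor\langle\delta\rangle\varphi$; $\langle\gamma^*\rangle\varphi\leftrightarrow\varphi\lor\langle\gamma\rangle\langle\gamma^*\rangle\varphi$;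 $\langle\psi?\rangle\varphi\leftrightarrow\psi\land\varphi$; $\langle\gamma^d\rangle\varphi\leftrightarrow\neg\langle\gamma\rangle\neg\varphi$; rules modus ponens, monotonicity (from $\varphi\to\psi$ infer $\langle\gamma\rangle\varphi\to\langle\gamma\rangle\psi$), bar induction (from $\langle\gamma\rangle\varphi\to\varphi$ infer $\langle\gamma^*\rangle\varphi\to\varphi$). $\mathsf{Full}$: the same axioms and rules instantiated over $\mathcal{L}_{Full}$, plus axioms $\langle\gamma\sqcap\delta\rangle\varphi\leftrightarrow\langle\gamma\rangle\varphi\land\langle\delta\rangle\varphi$, $\langle\gamma^\times\rangle\varphi\leftrightarrow\varphi\land\langle\gamma\rangle\langle\gamma^\times\rangle\varphi$, $\langle\psi!\rangle\varphi\leftrightarrow\psi\lor\varphi$, and the rule: from $\varphi\to\langle\gamma\rangle\varphi$ infer $\varphi\to\langle\gamma^\times\rangle\varphi$. -}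

module Defs where

open import Data.Nat using (ℕ)
open import Data.Bool using (Bool; true; false; not; _∨_)
open import Relation.Binary.PropositionalEquality using (_≡_)

data PropF : Set where
  pvar : ℕ → PropF
  pneg : PropF → PropF
  por  : PropF → PropF → PropF

evalProp : (ℕ → Bool) → PropF → Bool
evalProp v (pvar n)  = v n
evalProp v (pneg t)  = not (evalProp v t)
evalProp v (por s t) = evalProp v s ∨ evalProp v t

IsTautology : PropF → Set
IsTautology t = ∀ (v : ℕ → Bool) → evalProp v t ≡ true

infixr 30 ¬ᵖ_
infixl 25 _∨ᵖ_

mutual
  data ParFm (P G : Set) : Set where
    atomᵖ : P → ParFm P G
    ¬ᵖ_   : ParFm P G → ParFm P G
    _∨ᵖ_  : ParFm P G → ParFm P G → ParFm P G
    ⟨_⟩ᵖ_ : ParGm P G → ParFm P G → ParFm P G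

  data ParGm (P G : Set) : Set where
    gmᵖ   : G → ParGm P G
    _⨾ᵖ_  : ParGm P G → ParGm P G → ParGm P G
    _⊔ᵖ_  : ParGm P G → ParGm P G → ParGm P G
    _*ᵖ   : ParGm P G → ParGm P G
    _ᵈᵖ   : ParGm P G → ParGm P G
    _¿ᵖ   : ParFm P G → ParGm P G

module _ {P G : Set} where
  _∧ᵖ_ : ParFm P G → ParFm P G → ParFm P G
  φ ∧ᵖ ψ = ¬ᵖ (¬ᵖ φ ∨ᵖ ¬ᵖ ψ)

  _⇒ᵖ_ : ParFm P G → ParFm P G → ParFm P G
  φ ⇒ᵖ ψ = ¬ᵖ φ ∨ᵖ ψ

  _⇔ᵖ_ : ParFm P G → ParFm P G → ParFm P G
  φ ⇔ᵖ ψ = (φ ⇒ᵖ ψ) ∧ᵖ (ψ ⇒ᵖ φ)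

  substᵖ : (ℕ → ParFm P G) → PropF → ParFm P G
  substᵖ σ (pvar n)  = σ n
  substᵖ σ (pneg t)  = ¬ᵖ substᵖ σ t
  substᵖ σ (por s t) = substᵖ σ s ∨ᵖ substᵖ σ t

data ParThm {P G : Set} : ParFm P G → Set where
  taut    : ∀ (t : PropF) (σ : ℕ → ParFm P G) → IsTautology t → ParThm (substᵖ σ t)
  ax-seq  : ∀ γ δ φ → ParThm ((⟨ γ ⨾ᵖ δ ⟩ᵖ φ) ⇔ᵖ (⟨ γ ⟩ᵖ ⟨ δ ⟩ᵖ φ))
  ax-choice : ∀ γ δ φ → ParThm ((⟨ γ ⊔ᵖ δ ⟩ᵖ φ) ⇔ᵖ ((⟨ γ ⟩ᵖ φ) ∨ᵖ (⟨ δ ⟩ᵖ φ)))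
  ax-iter : ∀ γ φ → ParThm ((⟨ γ *ᵖ ⟩ᵖ φ) ⇔ᵖ (φ ∨ᵖ (⟨ γ ⟩ᵖ ⟨ γ *ᵖ ⟩ᵖ φ)))
  ax-test : ∀ ψ φ → ParThm ((⟨ ψ ¿ᵖ ⟩ᵖ φ) ⇔ᵖ (ψ ∧ᵖ φ))
  ax-dual : ∀ γ φ → ParThm ((⟨ γ ᵈᵖ ⟩ᵖ φ) ⇔ᵖ (¬ᵖ (⟨ γ ⟩ᵖ (¬ᵖ φ))))
  mp      : ∀ {φ ψ} → ParThm (φ ⇒ᵖ ψ) → ParThm φ → ParThm ψ
  mono    : ∀ {φ ψ} γ → ParThm (φ ⇒ᵖ ψ) → ParThm ((⟨ γ ⟩ᵖ φ) ⇒ᵖ (⟨ γ ⟩ᵖ ψ))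
  bar-ind : ∀ {φ} γ → ParThm ((⟨ γ ⟩ᵖ φ) ⇒ᵖ φ) → ParThm ((⟨ γ *ᵖ ⟩ᵖ φ) ⇒ᵖ φ)

infixr 30 ¬ᶠ_
infixl 25 _∨ᶠ_

mutual
  data FullFm (P G : Set) : Set where
    atomᶠ : P → FullFm P G
    ¬ᶠ_   : FullFm P G → FullFm P G
    _∨ᶠ_  : FullFm P G → FullFm P G → FullFm P G
    ⟨_⟩ᶠ_ : FullGm P G → FullFm P G → FullFm P G

  data FullGm (P G : Set) : Set where
    gmᶠ   : G → FullGm P G
    _⨾ᶠ_  : FullGm P G → FullGm P G → FullGm P G
    _⊔ᶠ_  : FullGm P G → FullGm P G → FullGm P G
    _⊓ᶠ_  : FullGm P G → FullGm P G → FullGm P G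
    _*ᶠ   : FullGm P G → FullGm P G
    _×ᶠ   : FullGm P G → FullGm P G
    _ᵈᶠ   : FullGm P G → FullGm P G
    _¿ᶠ   : FullFm P G → FullGm P G
    _!ᶠ   : FullFm P G → FullGm P G

module _ {P G : Set} where
  _∧ᶠ_ : FullFm P G → FullFm P G → FullFm P G
  φ ∧ᶠ ψ = ¬ᶠ (¬ᶠ φ ∨ᶠ ¬ᶠ ψ)

  _⇒ᶠ_ : FullFm P G → FullFm P G → FullFm P G
  φ ⇒ᶠ ψ = ¬ᶠ φ ∨ᶠ ψ

  _⇔ᶠ_ : FullFm P G → FullFm P G → FullFm P G
  φ ⇔ᶠ ψ = (φ ⇒ᶠ ψ) ∧ᶠ (ψ ⇒ᶠ φ)

  substᶠ : (ℕ → FullFm P G) → PropF → FullFm P G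
  substᶠ σ (pvar n)  = σ n
  substᶠ σ (pneg t)  = ¬ᶠ substᶠ σ t
  substᶠ σ (por s t) = substᶠ σ s ∨ᶠ substᶠ σ t

data FullThm {P G : Set} : FullFm P G → Set where
  taut    : ∀ (t : PropF) (σ : ℕ → FullFm P G) → IsTautology t → FullThm (substᶠ σ t)
  ax-seq  : ∀ γ δ φ → FullThm ((⟨ γ ⨾ᶠ δ ⟩ᶠ φ) ⇔ᶠ (⟨ γ ⟩ᶠ ⟨ δ ⟩ᶠ φ))
  ax-choice : ∀ γ δ φ → FullThm ((⟨ γ ⊔ᶠ δ ⟩ᶠ φ) ⇔ᶠ ((⟨ γ ⟩ᶠ φ) ∨ᶠ (⟨ δ ⟩ᶠ φ)))
  ax-iter : ∀ γ φ → FullThm ((⟨ γ *ᶠ ⟩ᶠ φ) ⇔ᶠ (φ ∨ᶠ (⟨ γ ⟩ᶠ ⟨ γ *ᶠ ⟩ᶠ φ)))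
  ax-test : ∀ ψ φ → FullThm ((⟨ ψ ¿ᶠ ⟩ᶠ φ) ⇔ᶠ (ψ ∧ᶠ φ))
  ax-dual : ∀ γ φ → FullThm ((⟨ γ ᵈᶠ ⟩ᶠ φ) ⇔ᶠ (¬ᶠ (⟨ γ ⟩ᶠ (¬ᶠ φ))))
  ax-dchoice : ∀ γ δ φ → FullThm ((⟨ γ ⊓ᶠ δ ⟩ᶠ φ) ⇔ᶠ ((⟨ γ ⟩ᶠ φ) ∧ᶠ (⟨ δ ⟩ᶠ φ)))
  ax-diter : ∀ γ φ → FullThm ((⟨ γ ×ᶠ ⟩ᶠ φ) ⇔ᶠ (φ ∧ᶠ (⟨ γ ⟩ᶠ ⟨ γ ×ᶠ ⟩ᶠ φ)))
  ax-dtest : ∀ ψ φ → FullThm ((⟨ ψ !ᶠ ⟩ᶠ φ) ⇔ᶠ (ψ ∨ᶠ φ))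
  mp      : ∀ {φ ψ} → FullThm (φ ⇒ᶠ ψ) → FullThm φ → FullThm ψ
  mono    : ∀ {φ ψ} γ → FullThm (φ ⇒ᶠ ψ) → FullThm ((⟨ γ ⟩ᶠ φ) ⇒ᶠ (⟨ γ ⟩ᶠ ψ))
  bar-ind : ∀ {φ} γ → FullThm ((⟨ γ ⟩ᶠ φ) ⇒ᶠ φ) → FullThm ((⟨ γ *ᶠ ⟩ᶠ φ) ⇒ᶠ φ)
  coind   : ∀ {φ} γ → FullThm (φ ⇒ᶠ (⟨ γ ⟩ᶠ φ)) → FullThm (φ ⇒ᶠ (⟨ γ ×ᶠ ⟩ᶠ φ))

mutual
  embF : ∀ {P G} → ParFm P G → FullFm P G
  embF (atomᵖ p)   = atomᶠ p
  embF (¬ᵖ φ)      = ¬ᶠ embF φ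
  embF (φ ∨ᵖ ψ)    = embF φ ∨ᶠ embF ψ
  embF (⟨ γ ⟩ᵖ φ)  = ⟨ embG γ ⟩ᶠ embF φ

  embG : ∀ {P G} → ParGm P G → FullGm P G
  embG (gmᵖ g)     = gmᶠ g
  embG (γ ⨾ᵖ δ)    = embG γ ⨾ᶠ embG δ
  embG (γ ⊔ᵖ δ)    = embG γ ⊔ᶠ embG δ
  embG (γ *ᵖ)      = embG γ *ᶠ
  embG (γ ᵈᵖ)      = embG γ ᵈᶠ
  embG (φ ¿ᵖ)      = embF φ ¿ᶠ

-- The normal-form translation (·)^nf : L_Full → L_NF ⊆ L_Full.
-- nf φ = φ^nf, nfNeg φ = (¬φ)^nf, nfG γ = γ^nf, nfDual γ = (γ^d)^nf.
-- The L_NF conjunction is rendered as the L_Full abbreviation ∧ᶠ,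
-- and the L_NF literal ¬p as ¬ᶠ (atomᶠ p).

mutual
  nf : ∀ {P G} → FullFm P G → FullFm P G
  nf (atomᶠ p)   = atomᶠ p
  nf (¬ᶠ φ)      = nfNeg φ
  nf (φ ∨ᶠ ψ)    = nf φ ∨ᶠ nf ψ
  nf (⟨ γ ⟩ᶠ φ)  = ⟨ nfG γ ⟩ᶠ nf φ

  nfNeg : ∀ {P G} → FullFm P G → FullFm P G
  nfNeg (atomᶠ p)  = ¬ᶠ atomᶠ p
  nfNeg (¬ᶠ φ)     = nf φ
  nfNeg (φ ∨ᶠ ψ)   = nfNeg φ ∧ᶠ nfNeg ψ
  nfNeg (⟨ γ ⟩ᶠ φ) = ⟨ nfDual γ ⟩ᶠ nfNeg φ

  nfG : ∀ {P G} → FullGm P G → FullGm P G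
  nfG (gmᶠ g)   = gmᶠ g
  nfG (γ ⨾ᶠ δ)  = nfG γ ⨾ᶠ nfG δ
  nfG (γ ⊔ᶠ δ)  = nfG γ ⊔ᶠ nfG δ
  nfG (γ ⊓ᶠ δ)  = nfG γ ⊓ᶠ nfG δ
  nfG (γ *ᶠ)    = nfG γ *ᶠ
  nfG (γ ×ᶠ)    = nfG γ ×ᶠ
  nfG (γ ᵈᶠ)    = nfDual γ
  nfG (φ ¿ᶠ)    = nf φ ¿ᶠ
  nfG (φ !ᶠ)    = nf φ !ᶠ

  nfDual : ∀ {P G} → FullGm P G → FullGm P G
  nfDual (gmᶠ g)   = gmᶠ g ᵈᶠ
  nfDual (γ ⨾ᶠ δ)  = nfDual γ ⨾ᶠ nfDual δ
  nfDual (γ ⊔ᶠ δ)  = nfDual γ ⊓ᶠ nfDual δ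
  nfDual (γ ⊓ᶠ δ)  = nfDual γ ⊔ᶠ nfDual δ
  nfDual (γ *ᶠ)    = nfDual γ ×ᶠ
  nfDual (γ ×ᶠ)    = nfDual γ *ᶠ
  nfDual (γ ᵈᶠ)    = nfG γ
  nfDual (φ ¿ᶠ)    = nfNeg φ !ᶠ
  nfDual (φ !ᶠ)    = nfNeg φ ¿ᶠ

-- Read ⊓, × and ! in Par as the abbreviations γ ⊓ δ = (γᵈ ⊔ δᵈ)ᵈ, γ× = ((γᵈ)*)ᵈ
-- and φ! = ((¬φ)?)ᵈ.  Under this translation tr every axiom and rule of Full is
-- derivable in Par, so Full ⊢ ψ implies Par ⊢ tr ψ.  It remains to see that
-- tr (φ^nf) is Par-equivalent to φ, by a simultaneous induction together with
-- (¬φ)^nf ↔ ¬φ, γ^nf ≈ γ and (γᵈ)^nf ≈ γᵈ, where games are equivalent when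
-- ⟨γ⟩χ ↔ ⟨γ'⟩χ for all χ; this equivalence is a congruence for all game
-- constructors of Par.
module Submission where

open import Defs
open import Data.Nat using (ℕ)
open import Data.Bool using (Bool; true; false; _∧_)
open import Data.Bool.Properties using (∧-conicalˡ; ∧-conicalʳ)
open import Function.Bundles using (_↣_)
open import Relation.Binary.PropositionalEquality using (_≡_; refl; subst; sym; cong; cong₂)

all : (Bool → Bool) → Bool
all f = f true ∧ f false

all-sound : ∀ f → all f ≡ true → ∀ a → f a ≡ true
all-sound f h true  = ∧-conicalˡ (f true) (f false) h
all-sound f h false = ∧-conicalʳ (f true) (f false) h

all₄ : (Bool → Bool → Bool → Bool → Bool) → Bool
all₄ f = all λ a → all λ b → all λ c → all (f a b c)

all₄-sound : ∀ f → all₄ f ≡ true → ∀ a b c d → f a b c d ≡ true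
all₄-sound f h a b c d =
  all-sound (f a b c)
    (all-sound (λ c → all (f a b c))
      (all-sound (λ b → all λ c → all (f a b c))
        (all-sound (λ a → all λ b → all λ c → all (f a b c)) h a) b) c) d

valuation₄ : Bool → Bool → Bool → Bool → ℕ → Bool
valuation₄ a b c d 0 = a
valuation₄ a b c d 1 = b
valuation₄ a b c d 2 = c
valuation₄ a b c d _ = d

-- For t built from pvar 0 … pvar 3 the conclusion is definitionally
-- IsTautology t, so 'valid₄ t refl' decides tautologies by evaluation.
valid₄ : (t : PropF) → all₄ (λ a b c d → evalProp (valuation₄ a b c d) t) ≡ true →
         (v : ℕ → Bool) → evalProp (valuation₄ (v 0) (v 1) (v 2) (v 3)) t ≡ true
valid₄ t h v = all₄-sound (λ a b c d → evalProp (valuation₄ a b c d) t) h (v 0) (v 1) (v 2) (v 3)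

x₀ x₁ x₂ x₃ : PropF
x₀ = pvar 0
x₁ = pvar 1
x₂ = pvar 2
x₃ = pvar 3

infixr 20 _⇒ₜ_

_⇒ₜ_ : PropF → PropF → PropF
s ⇒ₜ t = por (pneg s) t

_∧ₜ_ : PropF → PropF → PropF
s ∧ₜ t = pneg (por (pneg s) (pneg t))

_⇔ₜ_ : PropF → PropF → PropF
s ⇔ₜ t = (s ⇒ₜ t) ∧ₜ (t ⇒ₜ s)

module _ {P G : Set} where
  private
    Fm = ParFm P G
    Gm = ParGm P G

  substitution₄ : Fm → Fm → Fm → Fm → ℕ → Fm
  substitution₄ A B C D 0 = A
  substitution₄ A B C D 1 = B
  substitution₄ A B C D 2 = C
  substitution₄ A B C D _ = D

  tautology : (t : PropF) → IsTautology t → (A B C D : Fm) →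
              ParThm (substᵖ (substitution₄ A B C D) t)
  tautology t h A B C D = taut t (substitution₄ A B C D) h

  ⇒-refl : ∀ A → ParThm (A ⇒ᵖ A)
  ⇒-refl A = tautology t (valid₄ t refl) A A A A
    where t = x₀ ⇒ₜ x₀

  ⇒-trans : ∀ {A B C} → ParThm (A ⇒ᵖ B) → ParThm (B ⇒ᵖ C) → ParThm (A ⇒ᵖ C)
  ⇒-trans {A} {B} {C} h₁ h₂ = mp (mp (tautology t (valid₄ t refl) A B C A) h₁) h₂
    where t = (x₀ ⇒ₜ x₁) ⇒ₜ (x₁ ⇒ₜ x₂) ⇒ₜ x₀ ⇒ₜ x₂

  ⇔-intro : ∀ {A B} → ParThm (A ⇒ᵖ B) → ParThm (B ⇒ᵖ A) → ParThm (A ⇔ᵖ B)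
  ⇔-intro {A} {B} h₁ h₂ = mp (mp (tautology t (valid₄ t refl) A B A A) h₁) h₂
    where t = (x₀ ⇒ₜ x₁) ⇒ₜ (x₁ ⇒ₜ x₀) ⇒ₜ (x₀ ⇔ₜ x₁)

  ⇔-elimˡ : ∀ {A B} → ParThm (A ⇔ᵖ B) → ParThm (A ⇒ᵖ B)
  ⇔-elimˡ {A} {B} = mp (tautology t (valid₄ t refl) A B A A)
    where t = (x₀ ⇔ₜ x₁) ⇒ₜ x₀ ⇒ₜ x₁

  ⇔-elimʳ : ∀ {A B} → ParThm (A ⇔ᵖ B) → ParThm (B ⇒ᵖ A)
  ⇔-elimʳ {A} {B} = mp (tautology t (valid₄ t refl) A B A A)
    where t = (x₀ ⇔ₜ x₁) ⇒ₜ x₁ ⇒ₜ x₀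

  contraposition : ∀ {A B} → ParThm (A ⇒ᵖ B) → ParThm (¬ᵖ B ⇒ᵖ ¬ᵖ A)
  contraposition {A} {B} = mp (tautology t (valid₄ t refl) A B A A)
    where t = (x₀ ⇒ₜ x₁) ⇒ₜ pneg x₁ ⇒ₜ pneg x₀

  ∨-mono : ∀ {A B A' B'} → ParThm (A ⇒ᵖ A') → ParThm (B ⇒ᵖ B') → ParThm (A ∨ᵖ B ⇒ᵖ A' ∨ᵖ B')
  ∨-mono {A} {B} {A'} {B'} h₁ h₂ = mp (mp (tautology t (valid₄ t refl) A B A' B') h₁) h₂
    where t = (x₀ ⇒ₜ x₂) ⇒ₜ (x₁ ⇒ₜ x₃) ⇒ₜ por x₀ x₁ ⇒ₜ por x₂ x₃

  ¬¬-intro : ∀ A → ParThm (A ⇒ᵖ ¬ᵖ ¬ᵖ A)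
  ¬¬-intro A = tautology t (valid₄ t refl) A A A A
    where t = x₀ ⇒ₜ pneg (pneg x₀)

  ¬¬-elim : ∀ A → ParThm (¬ᵖ ¬ᵖ A ⇒ᵖ A)
  ¬¬-elim A = tautology t (valid₄ t refl) A A A A
    where t = pneg (pneg x₀) ⇒ₜ x₀

  ∨-introˡ : ∀ A B → ParThm (A ⇒ᵖ A ∨ᵖ B)
  ∨-introˡ A B = tautology t (valid₄ t refl) A B A A
    where t = x₀ ⇒ₜ por x₀ x₁

  ∨-introʳ : ∀ A B → ParThm (B ⇒ᵖ A ∨ᵖ B)
  ∨-introʳ A B = tautology t (valid₄ t refl) A B A A
    where t = x₁ ⇒ₜ por x₀ x₁

  ¬∧¬-⇔-∨ : ∀ A B → ParThm (¬ᵖ (¬ᵖ A ∧ᵖ ¬ᵖ B) ⇔ᵖ A ∨ᵖ B)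
  ¬∧¬-⇔-∨ A B = tautology t (valid₄ t refl) A B A A
    where t = pneg (pneg x₀ ∧ₜ pneg x₁) ⇔ₜ por x₀ x₁

  ⇔-refl : ∀ A → ParThm (A ⇔ᵖ A)
  ⇔-refl A = ⇔-intro (⇒-refl A) (⇒-refl A)

  ⇔-sym : ∀ {A B} → ParThm (A ⇔ᵖ B) → ParThm (B ⇔ᵖ A)
  ⇔-sym e = ⇔-intro (⇔-elimʳ e) (⇔-elimˡ e)

  ⇔-trans : ∀ {A B C} → ParThm (A ⇔ᵖ B) → ParThm (B ⇔ᵖ C) → ParThm (A ⇔ᵖ C)
  ⇔-trans e₁ e₂ = ⇔-intro (⇒-trans (⇔-elimˡ e₁) (⇔-elimˡ e₂)) (⇒-trans (⇔-elimʳ e₂) (⇔-elimʳ e₁))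

  ¬¬-⇔ : ∀ A → ParThm (¬ᵖ ¬ᵖ A ⇔ᵖ A)
  ¬¬-⇔ A = ⇔-intro (¬¬-elim A) (¬¬-intro A)

  ¬-cong : ∀ {A B} → ParThm (A ⇔ᵖ B) → ParThm (¬ᵖ A ⇔ᵖ ¬ᵖ B)
  ¬-cong e = ⇔-intro (contraposition (⇔-elimʳ e)) (contraposition (⇔-elimˡ e))

  ∨-cong : ∀ {A B A' B'} → ParThm (A ⇔ᵖ A') → ParThm (B ⇔ᵖ B') → ParThm (A ∨ᵖ B ⇔ᵖ A' ∨ᵖ B')
  ∨-cong e₁ e₂ = ⇔-intro (∨-mono (⇔-elimˡ e₁) (⇔-elimˡ e₂)) (∨-mono (⇔-elimʳ e₁) (⇔-elimʳ e₂))

  ∧-cong : ∀ {A B A' B'} → ParThm (A ⇔ᵖ A') → ParThm (B ⇔ᵖ B') → ParThm ((A ∧ᵖ B) ⇔ᵖ (A' ∧ᵖ B'))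
  ∧-cong e₁ e₂ = ¬-cong (∨-cong (¬-cong e₁) (¬-cong e₂))

  ⟨⟩-cong : ∀ {A B} γ → ParThm (A ⇔ᵖ B) → ParThm ((⟨ γ ⟩ᵖ A) ⇔ᵖ (⟨ γ ⟩ᵖ B))
  ⟨⟩-cong γ e = ⇔-intro (mono γ (⇔-elimˡ e)) (mono γ (⇔-elimʳ e))

  ⟨ᵈ⟩¬-⇔-¬⟨⟩ : ∀ γ φ → ParThm ((⟨ γ ᵈᵖ ⟩ᵖ ¬ᵖ φ) ⇔ᵖ ¬ᵖ (⟨ γ ⟩ᵖ φ))
  ⟨ᵈ⟩¬-⇔-¬⟨⟩ γ φ = ⇔-trans (ax-dual γ (¬ᵖ φ)) (¬-cong (⟨⟩-cong γ (¬¬-⇔ φ)))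

  _⊓ᵖ_ : Gm → Gm → Gm
  γ ⊓ᵖ δ = ((γ ᵈᵖ) ⊔ᵖ (δ ᵈᵖ)) ᵈᵖ

  _×ᵖ : Gm → Gm
  γ ×ᵖ = ((γ ᵈᵖ) *ᵖ) ᵈᵖ

  _!ᵖ : Fm → Gm
  φ !ᵖ = ((¬ᵖ φ) ¿ᵖ) ᵈᵖ

  ax-dchoiceᵖ : ∀ γ δ φ → ParThm ((⟨ γ ⊓ᵖ δ ⟩ᵖ φ) ⇔ᵖ ((⟨ γ ⟩ᵖ φ) ∧ᵖ (⟨ δ ⟩ᵖ φ)))
  ax-dchoiceᵖ γ δ φ =
    ⇔-trans (ax-dual _ φ)
      (¬-cong (⇔-trans (ax-choice (γ ᵈᵖ) (δ ᵈᵖ) (¬ᵖ φ))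
                       (∨-cong (⟨ᵈ⟩¬-⇔-¬⟨⟩ γ φ) (⟨ᵈ⟩¬-⇔-¬⟨⟩ δ φ))))

  ax-diterᵖ : ∀ γ φ → ParThm ((⟨ γ ×ᵖ ⟩ᵖ φ) ⇔ᵖ (φ ∧ᵖ (⟨ γ ⟩ᵖ ⟨ γ ×ᵖ ⟩ᵖ φ)))
  ax-diterᵖ γ φ =
    ⇔-trans (ax-dual ((γ ᵈᵖ) *ᵖ) φ)
      (¬-cong (⇔-trans (ax-iter (γ ᵈᵖ) (¬ᵖ φ))
                       (∨-cong (⇔-refl (¬ᵖ φ))
                               (⇔-trans (⟨⟩-cong (γ ᵈᵖ) ⟨ᵈ*⟩¬-⇔-¬⟨×⟩)
                                        (⟨ᵈ⟩¬-⇔-¬⟨⟩ γ (⟨ γ ×ᵖ ⟩ᵖ φ))))))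
    where
      ⟨ᵈ*⟩¬-⇔-¬⟨×⟩ : ParThm ((⟨ (γ ᵈᵖ) *ᵖ ⟩ᵖ ¬ᵖ φ) ⇔ᵖ ¬ᵖ (⟨ γ ×ᵖ ⟩ᵖ φ))
      ⟨ᵈ*⟩¬-⇔-¬⟨×⟩ = ⇔-sym (⇔-trans (¬-cong (ax-dual ((γ ᵈᵖ) *ᵖ) φ)) (¬¬-⇔ _))

  ax-dtestᵖ : ∀ ψ φ → ParThm ((⟨ ψ !ᵖ ⟩ᵖ φ) ⇔ᵖ ψ ∨ᵖ φ)
  ax-dtestᵖ ψ φ = ⇔-trans (ax-dual _ φ) (⇔-trans (¬-cong (ax-test (¬ᵖ ψ) (¬ᵖ φ))) (¬∧¬-⇔-∨ ψ φ))

  -- Bar induction for γᵈ with the invariant ¬φ, contraposed.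
  coindᵖ : ∀ {φ} γ → ParThm (φ ⇒ᵖ (⟨ γ ⟩ᵖ φ)) → ParThm (φ ⇒ᵖ (⟨ γ ×ᵖ ⟩ᵖ φ))
  coindᵖ {φ} γ h =
    ⇒-trans (¬¬-intro φ)
      (⇒-trans (contraposition (bar-ind (γ ᵈᵖ) (⇒-trans (⇔-elimˡ (⟨ᵈ⟩¬-⇔-¬⟨⟩ γ φ)) (contraposition h))))
               (⇔-elimʳ (ax-dual _ φ)))

  infix 4 _≈ᵍ_

  _≈ᵍ_ : Gm → Gm → Set
  γ ≈ᵍ γ' = ∀ χ → ParThm ((⟨ γ ⟩ᵖ χ) ⇔ᵖ (⟨ γ' ⟩ᵖ χ))

  ≈ᵍ-refl : ∀ {γ} → γ ≈ᵍ γ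
  ≈ᵍ-refl χ = ⇔-refl _

  ≈ᵍ-sym : ∀ {γ γ'} → γ ≈ᵍ γ' → γ' ≈ᵍ γ
  ≈ᵍ-sym e χ = ⇔-sym (e χ)

  ≈ᵍ-trans : ∀ {γ γ' γ''} → γ ≈ᵍ γ' → γ' ≈ᵍ γ'' → γ ≈ᵍ γ''
  ≈ᵍ-trans e₁ e₂ χ = ⇔-trans (e₁ χ) (e₂ χ)

  ⨾-cong : ∀ {γ γ' δ δ'} → γ ≈ᵍ γ' → δ ≈ᵍ δ' → γ ⨾ᵖ δ ≈ᵍ γ' ⨾ᵖ δ'
  ⨾-cong {γ} {γ'} {δ} {δ'} e₁ e₂ χ =
    ⇔-trans (ax-seq γ δ χ)
      (⇔-trans (⟨⟩-cong γ (e₂ χ)) (⇔-trans (e₁ (⟨ δ' ⟩ᵖ χ)) (⇔-sym (ax-seq γ' δ' χ))))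

  ⊔-cong : ∀ {γ γ' δ δ'} → γ ≈ᵍ γ' → δ ≈ᵍ δ' → γ ⊔ᵖ δ ≈ᵍ γ' ⊔ᵖ δ'
  ⊔-cong {γ} {γ'} {δ} {δ'} e₁ e₂ χ =
    ⇔-trans (ax-choice γ δ χ) (⇔-trans (∨-cong (e₁ χ) (e₂ χ)) (⇔-sym (ax-choice γ' δ' χ)))

  ᵈ-cong : ∀ {γ γ'} → γ ≈ᵍ γ' → γ ᵈᵖ ≈ᵍ γ' ᵈᵖ
  ᵈ-cong {γ} {γ'} e χ = ⇔-trans (ax-dual γ χ) (⇔-trans (¬-cong (e (¬ᵖ χ))) (⇔-sym (ax-dual γ' χ)))

  ¿-cong : ∀ {A A'} → ParThm (A ⇔ᵖ A') → A ¿ᵖ ≈ᵍ A' ¿ᵖ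
  ¿-cong {A} {A'} e χ = ⇔-trans (ax-test A χ) (⇔-trans (∧-cong e (⇔-refl χ)) (⇔-sym (ax-test A' χ)))

  -- Bar induction for γ with the invariant ⟨γ'*⟩χ.
  ⟨*⟩-≈ᵍ-⇒ : ∀ {γ γ'} → γ ≈ᵍ γ' → ∀ χ → ParThm ((⟨ γ *ᵖ ⟩ᵖ χ) ⇒ᵖ (⟨ γ' *ᵖ ⟩ᵖ χ))
  ⟨*⟩-≈ᵍ-⇒ {γ} {γ'} e χ = ⇒-trans (mono (γ *ᵖ) χ⇒⟨γ'*⟩χ) (bar-ind γ ⟨γ⟩⟨γ'*⟩χ⇒⟨γ'*⟩χ)
    where
      unfold⇒ : ParThm ((χ ∨ᵖ (⟨ γ' ⟩ᵖ ⟨ γ' *ᵖ ⟩ᵖ χ)) ⇒ᵖ (⟨ γ' *ᵖ ⟩ᵖ χ))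
      unfold⇒ = ⇔-elimʳ (ax-iter γ' χ)

      χ⇒⟨γ'*⟩χ : ParThm (χ ⇒ᵖ (⟨ γ' *ᵖ ⟩ᵖ χ))
      χ⇒⟨γ'*⟩χ = ⇒-trans (∨-introˡ χ _) unfold⇒

      ⟨γ⟩⟨γ'*⟩χ⇒⟨γ'*⟩χ : ParThm ((⟨ γ ⟩ᵖ ⟨ γ' *ᵖ ⟩ᵖ χ) ⇒ᵖ (⟨ γ' *ᵖ ⟩ᵖ χ))
      ⟨γ⟩⟨γ'*⟩χ⇒⟨γ'*⟩χ = ⇒-trans (⇔-elimˡ (e _)) (⇒-trans (∨-introʳ χ _) unfold⇒)

  *-cong : ∀ {γ γ'} → γ ≈ᵍ γ' → γ *ᵖ ≈ᵍ γ' *ᵖ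
  *-cong e χ = ⇔-intro (⟨*⟩-≈ᵍ-⇒ e χ) (⟨*⟩-≈ᵍ-⇒ (≈ᵍ-sym e) χ)

  ᵈᵈ-≈ᵍ : ∀ γ → (γ ᵈᵖ) ᵈᵖ ≈ᵍ γ
  ᵈᵈ-≈ᵍ γ χ = ⇔-trans (ax-dual (γ ᵈᵖ) χ) (⇔-trans (¬-cong (⟨ᵈ⟩¬-⇔-¬⟨⟩ γ χ)) (¬¬-⇔ _))

  ᵈ⨾ᵈ-≈ᵍ : ∀ γ δ → (γ ᵈᵖ) ⨾ᵖ (δ ᵈᵖ) ≈ᵍ (γ ⨾ᵖ δ) ᵈᵖ
  ᵈ⨾ᵈ-≈ᵍ γ δ χ =
    ⇔-trans (ax-seq (γ ᵈᵖ) (δ ᵈᵖ) χ)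
      (⇔-trans (⟨⟩-cong (γ ᵈᵖ) (ax-dual δ χ))
        (⇔-trans (⟨ᵈ⟩¬-⇔-¬⟨⟩ γ (⟨ δ ⟩ᵖ ¬ᵖ χ))
          (⇔-trans (¬-cong (⇔-sym (ax-seq γ δ (¬ᵖ χ)))) (⇔-sym (ax-dual (γ ⨾ᵖ δ) χ)))))

mutual
  tr : ∀ {P G} → FullFm P G → ParFm P G
  tr (atomᶠ p)  = atomᵖ p
  tr (¬ᶠ φ)     = ¬ᵖ tr φ
  tr (φ ∨ᶠ ψ)   = tr φ ∨ᵖ tr ψ
  tr (⟨ γ ⟩ᶠ φ) = ⟨ trᵍ γ ⟩ᵖ tr φ

  trᵍ : ∀ {P G} → FullGm P G → ParGm P G
  trᵍ (gmᶠ g)  = gmᵖ g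
  trᵍ (γ ⨾ᶠ δ) = trᵍ γ ⨾ᵖ trᵍ δ
  trᵍ (γ ⊔ᶠ δ) = trᵍ γ ⊔ᵖ trᵍ δ
  trᵍ (γ ⊓ᶠ δ) = trᵍ γ ⊓ᵖ trᵍ δ
  trᵍ (γ *ᶠ)   = trᵍ γ *ᵖ
  trᵍ (γ ×ᶠ)   = trᵍ γ ×ᵖ
  trᵍ (γ ᵈᶠ)   = trᵍ γ ᵈᵖ
  trᵍ (φ ¿ᶠ)   = tr φ ¿ᵖ
  trᵍ (φ !ᶠ)   = tr φ !ᵖ

tr-substᶠ : ∀ {P G} (σ : ℕ → FullFm P G) t → tr (substᶠ σ t) ≡ substᵖ (λ n → tr (σ n)) t
tr-substᶠ σ (pvar n)  = refl
tr-substᶠ σ (pneg t)  = cong ¬ᵖ_ (tr-substᶠ σ t)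
tr-substᶠ σ (por s t) = cong₂ _∨ᵖ_ (tr-substᶠ σ s) (tr-substᶠ σ t)

tr-sound : ∀ {P G} {φ : FullFm P G} → FullThm φ → ParThm (tr φ)
tr-sound (taut t σ h)       = subst ParThm (sym (tr-substᶠ σ t)) (taut t _ h)
tr-sound (ax-seq γ δ φ)     = ax-seq _ _ _
tr-sound (ax-choice γ δ φ)  = ax-choice _ _ _
tr-sound (ax-iter γ φ)      = ax-iter _ _
tr-sound (ax-test ψ φ)      = ax-test _ _
tr-sound (ax-dual γ φ)      = ax-dual _ _
tr-sound (ax-dchoice γ δ φ) = ax-dchoiceᵖ (trᵍ γ) (trᵍ δ) (tr φ)
tr-sound (ax-diter γ φ)     = ax-diterᵖ (trᵍ γ) (tr φ)
tr-sound (ax-dtest ψ φ)     = ax-dtestᵖ (tr ψ) (tr φ)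
tr-sound (mp h₁ h₂)         = mp (tr-sound h₁) (tr-sound h₂)
tr-sound (mono γ h)         = mono (trᵍ γ) (tr-sound h)
tr-sound (bar-ind γ h)      = bar-ind (trᵍ γ) (tr-sound h)
tr-sound (coind γ h)        = coindᵖ (trᵍ γ) (tr-sound h)

mutual
  tr-nf-⇔ : ∀ {P G} (φ : ParFm P G) → ParThm (tr (nf (embF φ)) ⇔ᵖ φ)
  tr-nf-⇔ (atomᵖ p)  = ⇔-refl _
  tr-nf-⇔ (¬ᵖ φ)     = tr-nfNeg-⇔ φ
  tr-nf-⇔ (φ ∨ᵖ ψ)   = ∨-cong (tr-nf-⇔ φ) (tr-nf-⇔ ψ)
  tr-nf-⇔ (⟨ γ ⟩ᵖ φ) = ⇔-trans (⟨⟩-cong _ (tr-nf-⇔ φ)) (trᵍ-nfG-≈ᵍ γ φ)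

  tr-nfNeg-⇔ : ∀ {P G} (φ : ParFm P G) → ParThm (tr (nfNeg (embF φ)) ⇔ᵖ ¬ᵖ φ)
  tr-nfNeg-⇔ (atomᵖ p)  = ⇔-refl _
  tr-nfNeg-⇔ (¬ᵖ φ)     = ⇔-trans (tr-nf-⇔ φ) (⇔-sym (¬¬-⇔ φ))
  tr-nfNeg-⇔ (φ ∨ᵖ ψ)   =
    ⇔-trans (¬-cong (∨-cong (¬-cong (tr-nfNeg-⇔ φ)) (¬-cong (tr-nfNeg-⇔ ψ))))
            (¬-cong (∨-cong (¬¬-⇔ φ) (¬¬-⇔ ψ)))
  tr-nfNeg-⇔ (⟨ γ ⟩ᵖ φ) =
    ⇔-trans (⟨⟩-cong _ (tr-nfNeg-⇔ φ)) (⇔-trans (trᵍ-nfDual-≈ᵍ γ (¬ᵖ φ)) (⟨ᵈ⟩¬-⇔-¬⟨⟩ γ φ))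

  trᵍ-nfG-≈ᵍ : ∀ {P G} (γ : ParGm P G) → trᵍ (nfG (embG γ)) ≈ᵍ γ
  trᵍ-nfG-≈ᵍ (gmᵖ g) = ≈ᵍ-refl
  trᵍ-nfG-≈ᵍ (γ ⨾ᵖ δ) = ⨾-cong (trᵍ-nfG-≈ᵍ γ) (trᵍ-nfG-≈ᵍ δ)
  trᵍ-nfG-≈ᵍ (γ ⊔ᵖ δ) = ⊔-cong (trᵍ-nfG-≈ᵍ γ) (trᵍ-nfG-≈ᵍ δ)
  trᵍ-nfG-≈ᵍ (γ *ᵖ)   = *-cong (trᵍ-nfG-≈ᵍ γ)
  trᵍ-nfG-≈ᵍ (γ ᵈᵖ)   = trᵍ-nfDual-≈ᵍ γ
  trᵍ-nfG-≈ᵍ (φ ¿ᵖ)   = ¿-cong (tr-nf-⇔ φ)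

  trᵍ-nfDual-≈ᵍ : ∀ {P G} (γ : ParGm P G) → trᵍ (nfDual (embG γ)) ≈ᵍ γ ᵈᵖ
  trᵍ-nfDual-≈ᵍ (gmᵖ g) = ≈ᵍ-refl
  trᵍ-nfDual-≈ᵍ (γ ⨾ᵖ δ) = ≈ᵍ-trans (⨾-cong (trᵍ-nfDual-≈ᵍ γ) (trᵍ-nfDual-≈ᵍ δ)) (ᵈ⨾ᵈ-≈ᵍ γ δ)
  trᵍ-nfDual-≈ᵍ (γ ⊔ᵖ δ) =
    ≈ᵍ-trans (ᵈ-cong (⊔-cong (ᵈ-cong (trᵍ-nfDual-≈ᵍ γ)) (ᵈ-cong (trᵍ-nfDual-≈ᵍ δ))))
             (ᵈ-cong (⊔-cong (ᵈᵈ-≈ᵍ γ) (ᵈᵈ-≈ᵍ δ)))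
  trᵍ-nfDual-≈ᵍ (γ *ᵖ) =
    ≈ᵍ-trans (ᵈ-cong (*-cong (ᵈ-cong (trᵍ-nfDual-≈ᵍ γ)))) (ᵈ-cong (*-cong (ᵈᵈ-≈ᵍ γ)))
  trᵍ-nfDual-≈ᵍ (γ ᵈᵖ) = ≈ᵍ-trans (trᵍ-nfG-≈ᵍ γ) (≈ᵍ-sym (ᵈᵈ-≈ᵍ γ))
  trᵍ-nfDual-≈ᵍ (φ ¿ᵖ) = ᵈ-cong (¿-cong (⇔-trans (¬-cong (tr-nfNeg-⇔ φ)) (¬¬-⇔ φ)))

proposition6 : (P G : Set) → P ↣ ℕ → G ↣ ℕ →
    (φ : ParFm P G) → FullThm (nf (embF φ)) → ParThm φ
proposition6 P G _ _ φ h = mp (⇔-elimˡ (tr-nf-⇔ φ)) (tr-sound h)
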